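{- Let $(h(n))_{n\in\mathbb{N}}$ be defined by $h(n)=1$ for all integers $n\le 1$ and $h(n)=h(n-h(n-1))+h(n-2)$ for $n>1$. Let $(t_n)_{n\in\mathbb{N}}$ be the Prouhet–Thue–Morse sequence given by $t_0=1$, $t_{2n}=t_n$, $t_{2n+1}=-t_n$. For $k\in\mathbb{N}$ and integers $N\ge 2^{k+1}-2$ put $F(k,N)=\sum_{i=0}^{2^k-1}t_i\,h(N-2i)$. Then for all $k\in\mathbb{N}$ and $n\ge 2^{k+1}-2$: $$F(k,2n)=\begin{cases}h(2n)&\text{if }k=0,\\ F(k-1,n)&\text{if }k\ge1,\end{cases}\qquad F(k,2n+1)=\begin{cases}n+1&\text{if }k=0,\\ 1&\text{if }k=1,\\ 0&\text{if }k\ge2.\end{cases}$$ In particular, for every $k\in\mathbb{N}$ and every $n\in\mathbb{N}_+$, $$\sum_{i=0}^{2^k-1}t_i\,h(2^{k+1}n+2^k-2i)=n+1.$$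
   Context: $\mathbb{N}=\{0,1,2,\dots\}$, $\mathbb{N}_+=\{1,2,\dots\}$. -}

module Defs where

open import Data.Nat using (ℕ; zero; suc; _+_; _*_; _∸_; _^_; _≤?_; _/_; _%_)
open import Data.Integer as ℤ using (ℤ; +_)
open import Relation.Nullary using (yes; no)

-- Course-of-values table for Hofstadter-type sequence
--   h(n) = 1 for all integers n ≤ 1,  h(n) = h(n - h(n-1)) + h(n-2) for n > 1.
-- hTab m i = h(i) for every i ≤ m.  Arguments n - h(n-1) ≤ 0 are
-- represented by truncated subtraction n ∸ h(n-1) = 0, where h(0) = 1
-- agrees with h(j) = 1 for all integers j ≤ 1.
hTab : ℕ → ℕ → ℕ
hTab zero i = 1
hTab (suc zero) i = 1
hTab (suc (suc m)) i = extend (hTab (suc m)) i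
  where
  extend : (ℕ → ℕ) → ℕ → ℕ
  extend prev j with j ≤? suc m
  ... | yes _ = prev j
  ... | no _ = prev (suc (suc m) ∸ prev (suc m)) + prev m

h : ℕ → ℕ
h n = hTab n n

-- Prouhet–Thue–Morse sequence: t 0 = 1, t (2n) = t n, t (2n+1) = - t n.
-- Implemented with fuel (n halvings always suffice).
tAux : ℕ → ℕ → ℤ
tAux zero n = + 1
tAux (suc f) n with n % 2
... | zero = tAux f (n / 2)
... | suc _ = ℤ.- tAux f (n / 2)

t : ℕ → ℤ
t n = tAux n n

sumBelow : ℕ → (ℕ → ℤ) → ℤ
sumBelow zero f = + 0
sumBelow (suc m) f = sumBelow m f ℤ.+ f m

-- F(k,N) = Σ_{i=0}^{2^k-1} t_i h(N - 2i)   (used for N ≥ 2^{k+1} - 2, so N ∸ 2i is exact)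
F : ℕ → ℕ → ℤ
F k N = sumBelow (2 ^ k) (λ i → t i ℤ.* + h (N ∸ 2 * i))

evenCase : ℕ → ℕ → ℤ
evenCase zero n = + h (2 * n)
evenCase (suc k) n = F k n

oddCase : ℕ → ℕ → ℤ
oddCase zero n = + (n + 1)
oddCase (suc zero) n = + 1
oddCase (suc (suc k)) n = + 0

private
  open import Data.List using (List; map; upTo; _∷_; [])
  open import Relation.Binary.PropositionalEquality using (_≡_; refl)
  _ : map h (upTo 20) ≡ 1 ∷ 1 ∷ 2 ∷ 2 ∷ 4 ∷ 3 ∷ 6 ∷ 4 ∷ 10 ∷ 5 ∷ 13 ∷ 6 ∷ 19 ∷ 7 ∷ 23 ∷ 8 ∷ 33 ∷ 9 ∷ 38 ∷ 10 ∷ []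
  _ = refl

-- The sequence satisfies h(2p+1) = p+1 and h(2p+2) = h(p+1) + h(2p), proved together with the
-- invariant h(2p+2) ≥ 2p+2.  Pairing the terms i = 2j and i = 2j+1 of F(k+1, N) and using
-- t(2j) = t(j), t(2j+1) = -t(j) gives F(k+1, N) = Σ_{j<2^k} t(j) (h(N-4j) - h(N-4j-2)).
-- For N = 2n these differences are h(n-2j), which is F(k, n); for N = 2n+1 they are all 1,
-- leaving Σ_{j<2^k} t(j), which is 1 for k = 0 and 0 for k ≥ 1 because the pairs cancel.
-- The last identity follows from the even case by induction on k, starting at h(2n+1) = n+1.

module Submission where

open import Defs
open import Data.Nat using (ℕ; zero; suc; _+_; _*_; _∸_; _^_; _≤_; _<_; _≤′_; ≤′-refl; ≤′-step; z≤n; s≤s; _≤?_; _/_; _%_)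
open import Data.Nat.Properties
open import Data.Nat.DivMod using (m*n%n≡0; m*n/n≡m; [m+kn]%n≡m%n; +-distrib-/-∣ʳ; m/n<m)
open import Data.Nat.Divisibility using (m∣m*n)
open import Data.Nat.Tactic.RingSolver as ℕ-Ring using ()
open import Data.Integer as ℤ using (ℤ; +_)
import Data.Integer.Properties as ℤₚ
open import Data.Integer.Tactic.RingSolver as ℤ-Ring using ()
open import Data.Product using (_×_; _,_; proj₁; proj₂)
open import Relation.Binary.PropositionalEquality
open import Relation.Nullary using (yes; no)
open import Data.Empty using (⊥-elim)

2+2q∸[1+q]≡1+q : ∀ q → 2 + 2 * q ∸ (1 + q) ≡ 1 + q
2+2q∸[1+q]≡1+q q = begin
  2 + 2 * q ∸ (1 + q)             ≡⟨ cong (_∸ (1 + q)) (sym (*-suc 2 q)) ⟩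
  (1 + q) + (1 + q + 0) ∸ (1 + q) ≡⟨ m+n∸m≡n (1 + q) _ ⟩
  1 + q + 0                       ≡⟨ +-identityʳ (1 + q) ⟩
  1 + q                           ∎
  where open ≡-Reasoning

2a∸2≤n⇒a≤1+n : ∀ a {n} → 2 * a ∸ 2 ≤ n → a ≤ suc n
2a∸2≤n⇒a≤1+n zero _ = z≤n
2a∸2≤n⇒a≤1+n (suc a) {n} 2a∸2≤n =
  s≤s (≤-trans (m≤m+n a (a + 0)) (subst (_≤ n) (cong (_∸ 2) (*-suc 2 a)) 2a∸2≤n))

a≤1+a*n+b : ∀ a b {n} → 1 ≤ n → a ≤ suc (a * n + b)
a≤1+a*n+b a b {n} 1≤n = begin
  a               ≡⟨ *-identityʳ a ⟨
  a * 1           ≤⟨ *-monoʳ-≤ a 1≤n ⟩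
  a * n           ≤⟨ m≤m+n (a * n) b ⟩
  a * n + b       ≤⟨ n≤1+n (a * n + b) ⟩
  suc (a * n + b) ∎
  where open ≤-Reasoning

+[m+n]-+n≡+m : ∀ m n → + (m + n) ℤ.- + n ≡ + m
+[m+n]-+n≡+m m n = trans (cong (ℤ._- + n) (ℤₚ.pos-+ m n)) (x+y-y≡x (+ m) (+ n))
  where
  x+y-y≡x : ∀ x y → x ℤ.+ y ℤ.- y ≡ x
  x+y-y≡x = ℤ-Ring.solve-∀

[2m]%2≡0 : ∀ m → 2 * m % 2 ≡ 0
[2m]%2≡0 m = trans (cong (_% 2) (*-comm 2 m)) (m*n%n≡0 m 2)

[2m]/2≡m : ∀ m → 2 * m / 2 ≡ m
[2m]/2≡m m = trans (cong (_/ 2) (*-comm 2 m)) (m*n/n≡m m 2)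

[1+2m]%2≡1 : ∀ m → (1 + 2 * m) % 2 ≡ 1
[1+2m]%2≡1 m = trans (cong (λ x → (1 + x) % 2) (*-comm 2 m)) ([m+kn]%n≡m%n 1 m 2)

[1+2m]/2≡m : ∀ m → (1 + 2 * m) / 2 ≡ m
[1+2m]/2≡m m = trans (+-distrib-/-∣ʳ 1 {d = 2} (m∣m*n m)) ([2m]/2≡m m)

n≤1+f⇒n/2≤f : ∀ {n f} → n ≤ suc f → n / 2 ≤ f
n≤1+f⇒n/2≤f {zero} _ = z≤n
n≤1+f⇒n/2≤f {suc n} n≤1+f = ≤-pred (<-≤-trans (m/n<m (suc n) 2 (s≤s (s≤s z≤n))) n≤1+f)

hTab-suc : ∀ m {i} → i ≤ m → hTab (suc m) i ≡ hTab m i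
hTab-suc zero _ = refl
hTab-suc (suc m) {i} i≤1+m with i ≤? suc m
... | yes _ = refl
... | no i≰1+m = ⊥-elim (i≰1+m i≤1+m)

hTab≡h : ∀ {i m} → i ≤′ m → hTab m i ≡ h i
hTab≡h ≤′-refl = refl
hTab≡h (≤′-step i≤′m) = trans (hTab-suc _ (≤′⇒≤ i≤′m)) (hTab≡h i≤′m)

hTab-positive : ∀ m i → 1 ≤ hTab m i
hTab-positive zero i = s≤s z≤n
hTab-positive (suc zero) i = s≤s z≤n
hTab-positive (suc (suc m)) i with i ≤? suc m | hTab-positive (suc m)
... | yes _ | positive = positive i
... | no _  | positive = ≤-trans (positive _) (m≤m+n _ _)

h-positive : ∀ i → 1 ≤ h i
h-positive i = hTab-positive i i

h-rec : ∀ m → h (2 + m) ≡ h (2 + m ∸ h (1 + m)) + h m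
h-rec m with 2 + m ≤? 1 + m
... | yes 2+m≤1+m = ⊥-elim (<-irrefl refl 2+m≤1+m)
... | no _ = cong₂ _+_ (hTab≡h (≤⇒≤′ back-in-table)) (hTab≡h (≤⇒≤′ (n≤1+n m)))
  where
  back-in-table : 2 + m ∸ hTab (1 + m) (1 + m) ≤ 1 + m
  back-in-table with hTab (1 + m) (1 + m) | hTab-positive (1 + m) (1 + m)
  ... | suc x | _ = m∸n≤m (1 + m) x

h-≤1 : ∀ {i} → i ≤ 1 → h i ≡ 1
h-≤1 z≤n = refl
h-≤1 (s≤s z≤n) = refl

h-≥2 : ∀ m → 2 ≤ h (2 + m)
h-≥2 m = ≤-trans (+-mono-≤ (h-positive (2 + m ∸ h (1 + m))) (h-positive m)) (≤-reflexive (sym (h-rec m)))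

-- h(2p+2) ≥ 2p+2 makes the first argument in the recursion for h(2p+3) at most 1, and
-- h(2p+3) = p+2 makes the first argument in the recursion for h(2p+4) equal to p+2.
h-odd-and-even-bound : ∀ p → h (1 + 2 * p) ≡ 1 + p × 2 + 2 * p ≤ h (2 + 2 * p)
h-odd-and-even-bound zero = refl , s≤s (s≤s z≤n)
h-odd-and-even-bound (suc p) =
  subst (λ m → h (1 + m) ≡ 2 + p × 2 + m ≤ h (2 + m)) (sym (*-suc 2 p)) (h-odd′ , h-even-bound′)
  where
  h-odd-p : h (1 + 2 * p) ≡ 1 + p
  h-odd-p = proj₁ (h-odd-and-even-bound p)

  h-even-bound-p : 2 + 2 * p ≤ h (2 + 2 * p)
  h-even-bound-p = proj₂ (h-odd-and-even-bound p)

  h-odd′ : h (3 + 2 * p) ≡ 2 + p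
  h-odd′ = begin
    h (3 + 2 * p)                                 ≡⟨ h-rec (1 + 2 * p) ⟩
    h (3 + 2 * p ∸ h (2 + 2 * p)) + h (1 + 2 * p) ≡⟨ cong₂ _+_ (h-≤1 small) h-odd-p ⟩
    2 + p                                         ∎
    where
    open ≡-Reasoning
    small : 3 + 2 * p ∸ h (2 + 2 * p) ≤ 1
    small = ≤-trans (∸-monoʳ-≤ (3 + 2 * p) h-even-bound-p) (≤-reflexive (m+n∸n≡m 1 (2 + 2 * p)))

  h-even-bound′ : 4 + 2 * p ≤ h (4 + 2 * p)
  h-even-bound′ = begin
    2 + (2 + 2 * p)                               ≤⟨ +-mono-≤ (h-≥2 p) h-even-bound-p ⟩
    h (2 + p) + h (2 + 2 * p)                     ≡⟨ cong (λ x → h x + h (2 + 2 * p)) (sym half) ⟩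
    h (4 + 2 * p ∸ (2 + p)) + h (2 + 2 * p)       ≡⟨ cong (λ x → h (4 + 2 * p ∸ x) + h (2 + 2 * p)) (sym h-odd′) ⟩
    h (4 + 2 * p ∸ h (3 + 2 * p)) + h (2 + 2 * p) ≡⟨ sym (h-rec (2 + 2 * p)) ⟩
    h (4 + 2 * p)                                 ∎
    where
    open ≤-Reasoning
    half : 4 + 2 * p ∸ (2 + p) ≡ 2 + p
    half = trans (cong (λ x → 2 + x ∸ (2 + p)) (sym (*-suc 2 p))) (2+2q∸[1+q]≡1+q (1 + p))

h-odd : ∀ p → h (1 + 2 * p) ≡ 1 + p
h-odd p = proj₁ (h-odd-and-even-bound p)

h-even : ∀ p → h (2 + 2 * p) ≡ h (1 + p) + h (2 * p)
h-even p = begin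
  h (2 + 2 * p)                             ≡⟨ h-rec (2 * p) ⟩
  h (2 + 2 * p ∸ h (1 + 2 * p)) + h (2 * p) ≡⟨ cong (λ x → h (2 + 2 * p ∸ x) + h (2 * p)) (h-odd p) ⟩
  h (2 + 2 * p ∸ (1 + p)) + h (2 * p)       ≡⟨ cong (λ x → h x + h (2 * p)) (2+2q∸[1+q]≡1+q p) ⟩
  h (1 + p) + h (2 * p)                     ∎
  where open ≡-Reasoning

Δ₂h : ℕ → ℤ
Δ₂h m = + h m ℤ.- + h (m ∸ 2)

Δ₂h-double : ∀ {m} → 1 ≤ m → Δ₂h (2 * m) ≡ + h m
Δ₂h-double {suc p} _ = begin
  Δ₂h (2 * suc p)                           ≡⟨ cong Δ₂h (*-suc 2 p) ⟩
  + h (2 + 2 * p) ℤ.- + h (2 * p)           ≡⟨ cong (λ x → + x ℤ.- + h (2 * p)) (h-even p) ⟩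
  + (h (1 + p) + h (2 * p)) ℤ.- + h (2 * p) ≡⟨ +[m+n]-+n≡+m (h (1 + p)) (h (2 * p)) ⟩
  + h (1 + p)                               ∎
  where open ≡-Reasoning

Δ₂h-double+1 : ∀ {m} → 1 ≤ m → Δ₂h (2 * m + 1) ≡ + 1
Δ₂h-double+1 {suc p} _ = begin
  Δ₂h (2 * suc p + 1)                     ≡⟨ cong Δ₂h (+-comm (2 * suc p) 1) ⟩
  Δ₂h (1 + 2 * suc p)                     ≡⟨ cong (λ x → Δ₂h (1 + x)) (*-suc 2 p) ⟩
  + h (3 + 2 * p) ℤ.- + h (1 + 2 * p)     ≡⟨ cong (λ x → + h (1 + x) ℤ.- + h (1 + 2 * p)) (sym (*-suc 2 p)) ⟩
  + h (1 + 2 * suc p) ℤ.- + h (1 + 2 * p) ≡⟨ cong₂ (λ x y → + x ℤ.- + y) (h-odd (suc p)) (h-odd p) ⟩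
  + (1 + (1 + p)) ℤ.- + (1 + p)           ≡⟨ +[m+n]-+n≡+m 1 (1 + p) ⟩
  + 1                                     ∎
  where open ≡-Reasoning

tAux-fuel-irrelevant : ∀ {f g n} → n ≤ f → n ≤ g → tAux f n ≡ tAux g n
tAux-fuel-irrelevant {zero} {zero} z≤n z≤n = refl
tAux-fuel-irrelevant {zero} {suc g} {zero} z≤n _ = tAux-fuel-irrelevant {zero} {g} {zero} z≤n z≤n
tAux-fuel-irrelevant {suc f} {zero} {zero} _ z≤n = tAux-fuel-irrelevant {f} {zero} {zero} z≤n z≤n
tAux-fuel-irrelevant {suc f} {suc g} {n} n≤1+f n≤1+g with n % 2
... | zero  = tAux-fuel-irrelevant (n≤1+f⇒n/2≤f n≤1+f) (n≤1+f⇒n/2≤f n≤1+g)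
... | suc _ = cong ℤ.-_ (tAux-fuel-irrelevant (n≤1+f⇒n/2≤f n≤1+f) (n≤1+f⇒n/2≤f n≤1+g))

tAux-suc-double : ∀ f m → tAux (suc f) (2 * m) ≡ tAux f m
tAux-suc-double f m with 2 * m % 2 | [2m]%2≡0 m
... | .0 | refl = cong (tAux f) ([2m]/2≡m m)

tAux-suc-double+1 : ∀ f m → tAux (suc f) (1 + 2 * m) ≡ ℤ.- tAux f m
tAux-suc-double+1 f m with (1 + 2 * m) % 2 | [1+2m]%2≡1 m
... | .1 | refl = cong (λ x → ℤ.- tAux f x) ([1+2m]/2≡m m)

t-double : ∀ n → t (2 * n) ≡ t n
t-double n = begin
  tAux (2 * n) (2 * n)     ≡⟨ tAux-fuel-irrelevant {2 * n} ≤-refl (n≤1+n _) ⟩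
  tAux (1 + 2 * n) (2 * n) ≡⟨ tAux-suc-double (2 * n) n ⟩
  tAux (2 * n) n           ≡⟨ tAux-fuel-irrelevant {2 * n} (m≤m+n n _) ≤-refl ⟩
  t n                      ∎
  where open ≡-Reasoning

t-double+1 : ∀ n → t (1 + 2 * n) ≡ ℤ.- t n
t-double+1 n = trans (tAux-suc-double+1 (2 * n) n) (cong ℤ.-_ (tAux-fuel-irrelevant (m≤m+n n _) ≤-refl))

sumBelow-cong : ∀ m {f g : ℕ → ℤ} → (∀ {j} → j < m → f j ≡ g j) → sumBelow m f ≡ sumBelow m g
sumBelow-cong zero _ = refl
sumBelow-cong (suc m) f≡g = cong₂ ℤ._+_ (sumBelow-cong m (λ j<m → f≡g (m<n⇒m<1+n j<m))) (f≡g ≤-refl)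

sumBelow-double : ∀ m (f : ℕ → ℤ) → sumBelow (2 * m) f ≡ sumBelow m (λ j → f (2 * j) ℤ.+ f (1 + 2 * j))
sumBelow-double zero f = refl
sumBelow-double (suc m) f = begin
  sumBelow (2 * suc m) f                               ≡⟨ cong (λ x → sumBelow x f) (*-suc 2 m) ⟩
  sumBelow (2 * m) f ℤ.+ f (2 * m) ℤ.+ f (1 + 2 * m)   ≡⟨ ℤₚ.+-assoc (sumBelow (2 * m) f) _ _ ⟩
  sumBelow (2 * m) f ℤ.+ (f (2 * m) ℤ.+ f (1 + 2 * m)) ≡⟨ cong (ℤ._+ (f (2 * m) ℤ.+ f (1 + 2 * m))) (sumBelow-double m f) ⟩
  sumBelow (suc m) (λ j → f (2 * j) ℤ.+ f (1 + 2 * j)) ∎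
  where open ≡-Reasoning

sumBelow-0 : ∀ m → sumBelow m (λ _ → + 0) ≡ + 0
sumBelow-0 zero = refl
sumBelow-0 (suc m) = trans (ℤₚ.+-identityʳ _) (sumBelow-0 m)

sumBelow-t-2^[1+k]≡0 : ∀ k → sumBelow (2 ^ suc k) t ≡ + 0
sumBelow-t-2^[1+k]≡0 k = begin
  sumBelow (2 * 2 ^ k) t                               ≡⟨ sumBelow-double (2 ^ k) t ⟩
  sumBelow (2 ^ k) (λ j → t (2 * j) ℤ.+ t (1 + 2 * j)) ≡⟨ sumBelow-cong (2 ^ k) (λ {j} _ → t-pair≡0 j) ⟩
  sumBelow (2 ^ k) (λ _ → + 0)                         ≡⟨ sumBelow-0 (2 ^ k) ⟩
  + 0                                                  ∎
  where
  open ≡-Reasoning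
  t-pair≡0 : ∀ j → t (2 * j) ℤ.+ t (1 + 2 * j) ≡ + 0
  t-pair≡0 j = trans (cong₂ ℤ._+_ (t-double j) (t-double+1 j)) (ℤₚ.+-inverseʳ (t j))

F-zero : ∀ N → F 0 N ≡ + h N
F-zero N = trans (ℤₚ.+-identityˡ _) (ℤₚ.*-identityˡ _)

F-suc : ∀ k N → F (suc k) N ≡ sumBelow (2 ^ k) (λ j → t j ℤ.* Δ₂h (N ∸ 2 * (2 * j)))
F-suc k N = trans (sumBelow-double (2 ^ k) _) (sumBelow-cong (2 ^ k) (λ {j} _ → pair j))
  where
  open ≡-Reasoning
  x*a+[-x]*b≡x*[a-b] : ∀ x a b → x ℤ.* a ℤ.+ (ℤ.- x) ℤ.* b ≡ x ℤ.* (a ℤ.- b)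
  x*a+[-x]*b≡x*[a-b] = ℤ-Ring.solve-∀
  shift : ∀ j → N ∸ 2 * (1 + 2 * j) ≡ N ∸ 2 * (2 * j) ∸ 2
  shift j = begin
    N ∸ 2 * (1 + 2 * j)   ≡⟨ cong (N ∸_) (trans (*-suc 2 (2 * j)) (+-comm 2 _)) ⟩
    N ∸ (2 * (2 * j) + 2) ≡⟨ ∸-+-assoc N (2 * (2 * j)) 2 ⟨
    N ∸ 2 * (2 * j) ∸ 2   ∎
  pair : ∀ j → t (2 * j) ℤ.* + h (N ∸ 2 * (2 * j)) ℤ.+ t (1 + 2 * j) ℤ.* + h (N ∸ 2 * (1 + 2 * j))
               ≡ t j ℤ.* Δ₂h (N ∸ 2 * (2 * j))
  pair j = begin
    t (2 * j) ℤ.* + h (N ∸ 2 * (2 * j)) ℤ.+ t (1 + 2 * j) ℤ.* + h (N ∸ 2 * (1 + 2 * j))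
      ≡⟨ cong₂ (λ x y → x ℤ.* + h (N ∸ 2 * (2 * j)) ℤ.+ y) (t-double j)
               (cong₂ (λ x m → x ℤ.* + h m) (t-double+1 j) (shift j)) ⟩
    t j ℤ.* + h (N ∸ 2 * (2 * j)) ℤ.+ (ℤ.- t j) ℤ.* + h (N ∸ 2 * (2 * j) ∸ 2)
      ≡⟨ x*a+[-x]*b≡x*[a-b] (t j) _ _ ⟩
    t j ℤ.* Δ₂h (N ∸ 2 * (2 * j))
      ∎

j<2^k⇒2j<n : ∀ k {n j} → 2 ^ (k + 1) ≤ suc n → j < 2 ^ k → 2 * j < n
j<2^k⇒2j<n k {n} {j} 2^[k+1]≤1+n j<2^k = ≤-pred (begin
  2 + 2 * j   ≡⟨ *-suc 2 j ⟨
  2 * suc j   ≤⟨ *-monoʳ-≤ 2 j<2^k ⟩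
  2 * 2 ^ k   ≡⟨ cong (2 ^_) (+-comm 1 k) ⟩
  2 ^ (k + 1) ≤⟨ 2^[k+1]≤1+n ⟩
  suc n       ∎)
  where open ≤-Reasoning

F-suc-even : ∀ k n → 2 ^ (k + 1) ≤ suc n → F (suc k) (2 * n) ≡ F k n
F-suc-even k n bound = trans (F-suc k (2 * n)) (sumBelow-cong (2 ^ k) (λ {j} j<2^k →
  cong (t j ℤ.*_) (gap j (j<2^k⇒2j<n k bound j<2^k))))
  where
  gap : ∀ j → 2 * j < n → Δ₂h (2 * n ∸ 2 * (2 * j)) ≡ + h (n ∸ 2 * j)
  gap j 2j<n = trans (cong Δ₂h (sym (*-distribˡ-∸ 2 n (2 * j)))) (Δ₂h-double (m<n⇒0<n∸m 2j<n))

F-suc-odd : ∀ k n → 2 ^ (k + 1) ≤ suc n → F (suc k) (2 * n + 1) ≡ sumBelow (2 ^ k) t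
F-suc-odd k n bound = trans (F-suc k (2 * n + 1)) (sumBelow-cong (2 ^ k) (λ {j} j<2^k →
  trans (cong (t j ℤ.*_) (gap j (j<2^k⇒2j<n k bound j<2^k))) (ℤₚ.*-identityʳ (t j))))
  where
  gap : ∀ j → 2 * j < n → Δ₂h (2 * n + 1 ∸ 2 * (2 * j)) ≡ + 1
  gap j 2j<n = begin
    Δ₂h (2 * n + 1 ∸ 2 * (2 * j)) ≡⟨ cong Δ₂h (+-∸-comm 1 (*-monoʳ-≤ 2 (<⇒≤ 2j<n))) ⟩
    Δ₂h (2 * n ∸ 2 * (2 * j) + 1) ≡⟨ cong (λ m → Δ₂h (m + 1)) (*-distribˡ-∸ 2 n (2 * j)) ⟨
    Δ₂h (2 * (n ∸ 2 * j) + 1)     ≡⟨ Δ₂h-double+1 (m<n⇒0<n∸m 2j<n) ⟩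
    + 1                           ∎
    where open ≡-Reasoning

F-even : ∀ k n → 2 ^ (k + 1) ∸ 2 ≤ n → F k (2 * n) ≡ evenCase k n
F-even zero n _ = F-zero (2 * n)
F-even (suc k) n bound = F-suc-even k n (2a∸2≤n⇒a≤1+n (2 ^ (k + 1)) bound)

F-odd : ∀ k n → 2 ^ (k + 1) ∸ 2 ≤ n → F k (2 * n + 1) ≡ oddCase k n
F-odd zero n _ = trans (F-zero (2 * n + 1)) (cong +_ h[2n+1]≡n+1)
  where
  h[2n+1]≡n+1 : h (2 * n + 1) ≡ n + 1
  h[2n+1]≡n+1 = trans (cong h (+-comm (2 * n) 1)) (trans (h-odd n) (+-comm 1 n))
F-odd (suc k) n bound = trans (F-suc-odd k n (2a∸2≤n⇒a≤1+n (2 ^ (k + 1)) bound)) (sum-t k)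
  where
  sum-t : ∀ k → sumBelow (2 ^ k) t ≡ oddCase (suc k) n
  sum-t zero = refl
  sum-t (suc k) = sumBelow-t-2^[1+k]≡0 k

F-dyadic : ∀ k n → 1 ≤ n → F k (2 ^ (k + 1) * n + 2 ^ k) ≡ + (n + 1)
F-dyadic zero n _ = F-odd zero n z≤n
F-dyadic (suc k) n 1≤n = begin
  F (suc k) (2 * 2 ^ (k + 1) * n + 2 * 2 ^ k) ≡⟨ cong (F (suc k)) (2a*n+2b≡2[a*n+b] (2 ^ (k + 1)) (2 ^ k) n) ⟩
  F (suc k) (2 * M)                           ≡⟨ F-suc-even k M (a≤1+a*n+b (2 ^ (k + 1)) (2 ^ k) 1≤n) ⟩
  F k M                                       ≡⟨ F-dyadic k n 1≤n ⟩
  + (n + 1)                                   ∎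
  where
  open ≡-Reasoning
  M : ℕ
  M = 2 ^ (k + 1) * n + 2 ^ k
  2a*n+2b≡2[a*n+b] : ∀ a b n → 2 * a * n + 2 * b ≡ 2 * (a * n + b)
  2a*n+2b≡2[a*n+b] = ℕ-Ring.solve-∀

theorem3p3 :
    ((k n : ℕ) → 2 ^ (k + 1) ∸ 2 ≤ n →
      (F k (2 * n) ≡ evenCase k n) × (F k (2 * n + 1) ≡ oddCase k n))
    × ((k n : ℕ) → 1 ≤ n →
      sumBelow (2 ^ k) (λ i → t i ℤ.* + h (2 ^ (k + 1) * n + 2 ^ k ∸ 2 * i)) ≡ + (n + 1))
theorem3p3 = (λ k n bound → F-even k n bound , F-odd k n bound) , F-dyadic
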